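{- The rewriting relation $\to$ on let-terms preserves typing: if $\ell\to\ell'$ and $\ell$ is well-typed of type $T$, then $\ell'$ is well-typed of type $T$ and $FV(\ell)=FV(\ell')$.
   Context: Types: positive $P,Q::=\mathsf{Bool}\mid P\otimes Q$; arrow $N::=P\multimap T$; let-term types $T,U::=P\mid N\mid P\otimes T$. Each variable carries a fixed type $\mathsf{ty}(v)$, positive or arrow; $x,y,z$ positive variables, $f,g,h$ arrow variables, $v,w$ either. Constants $M$ are stochastic matrices of type $P\multimap Q$ (or $0$-ary of type $Q$). Syntax: patterns $\vec v::=v\mid(\vec v,\vec v')$ (components with disjoint variables); expressions $e::=v\mid M(\vec x)\mid f\,\vec x\mid (e,e')\mid \lambda\vec x.e\mid \mathtt{let}\ \vec v=e\ \mathtt{in}\ e'$ ($\vec x$ a pattern of positive variables; a pattern is positive if all its variables are); let-terms $\ell::=\vec v\mid \mathtt{let}\ \vec v=e\ \mathtt{in}\ \ell$. $\lambda$ and $\mathtt{let}$ bind the pattern's variables in the body; $FV$ and $FV^a$ (arrow free variables) as usual. Typing: $v:\mathsf{ty}(v)$; $f:P\multimap T,\vec x:P\Rightarrow f\vec x:T$; $M:P\multimap Q,\vec x:P\Rightarrow M(\vec x):Q$; $\vec x:P,e:T\Rightarrow\lambda\vec x.e:P\multimap T$; $e:P,e':T$, $FV^a(e)\cap FV^a(e')=\emptyset\Rightarrow(e,e'):P\otimes T$; $\vec v:T,e:T,e':U$, $FV^a(e)\cap FV^a(e')=\emptyset$, each arrow variable of $\vec v$ in $FV^a(e')$ $\Rightarrow\mathtt{let}\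 \vec v=e\ \mathtt{in}\ e':U$. A well-typed pattern has at most one arrow variable, denoted $\vec v^a$; $\vec v^+$ is the pattern with it removed. Write $(\vec v_1=e_1;\vec v_2=e_2\ \mathtt{in}\ \ell)$ for $\mathtt{let}\ \vec v_1=e_1\ \mathtt{in}\ \mathtt{let}\ \vec v_2=e_2\ \mathtt{in}\ \ell$. Bound variables are pairwise distinct and distinct from free variables. Rewriting rules ($\ell$ a let-term): ($S_1$) $(\vec v_1=e_1;\vec v_2=e_2\ \mathtt{in}\ \ell)\to(\vec v_2=e_2;\vec v_1=e_1\ \mathtt{in}\ \ell)$ if $FV(\vec v_1)\cap FV(e_2)=\emptyset$; ($S_2$) $(\vec v_1=e_1;\vec v_2=e_2\ \mathtt{in}\ \ell)\to(f=\lambda\vec x.e_2;\vec v_1=e_1;\vec v_2=f\vec x\ \mathtt{in}\ \ell)$ ($f$ a fresh arrow variable) if $\vec x=FV(\vec v_1)\cap FV(e_2)$ is positive and non-empty; ($S_3$) $(\vec v_1=e_1;\vec v_2=e_2\ \mathtt{in}\ \ell)\to((\vec v_1^+,\vec v_2)=(\mathtt{let}\ \vec v_1=e_1\ \mathtt{in}\ (\vec v_1^+,e_2))\ \mathtt{in}\ \ell)$ if $\vec v_1^a=f$ with $f\in FV(e_2)$; ($M$) $(\vec v_1=e_1;\vec v_2=e_2\ \mathtt{in}\ \ell)\to((\vec v_1,\vec v_2)=(\mathtt{let}\ \vec v_1=e_1\ \mathtt{in}\ (\vec v_1,e_2))\ \mathtt{in}\ \ell)$ if $\vec v_1$ is positive;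 ($E_x$) $(\mathtt{let}\ \vec v=e_1\ \mathtt{in}\ \ell)\to(\mathtt{let}\ \vec v'=(\mathtt{let}\ \vec v=e_1\ \mathtt{in}\ \vec v')\ \mathtt{in}\ \ell)$ if $x\notin FV(\ell)$ and $\vec v'$ is non-empty and is obtained from $\vec v$ by removing the positive variable $x$. When $\vec v^+$ is empty, $(\vec v^+,e)$ stands for $e$ (and $(\vec v^+,\vec w)$ for $\vec w$). The relation $\to$ is obtained by applying one of these rules to a let-term or to any of its tails $\ell$ inside $\mathtt{let}\ \vec v_1=e_1\ \mathtt{in}\cdots\mathtt{let}\ \vec v_k=e_k\ \mathtt{in}\ \ell$. -}

module Defs where

open import Data.Nat using (ℕ)
open import Data.Maybe using (Maybe; just; nothing)
open import Data.Product using (_×_; _,_; Σ)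
open import Data.List using (List; []; _∷_; _++_)
open import Data.List.Membership.Propositional using (_∈_)
open import Data.List.Relation.Unary.Unique.Propositional using (Unique)
open import Data.Empty using (⊥)
open import Relation.Nullary using (¬_)
open import Relation.Binary.PropositionalEquality using (_≡_)
open import Function.Bundles using (_⇔_)

-- One raw grammar of type expressions; the paper's syntactic
-- classes are carved out by predicates:
--   positive  P,Q ::= Bool | P ⊗ Q                  (Pos)
--   arrow     N   ::= P ⊸ T                         (Arr)
--   let-types T,U ::= P | N | P ⊗ T                 (TyT)
-- (Using a single grammar means P ⊗ Q is the same object whether read
-- as a positive type or as P ⊗ T with T = Q.)

infixr 6 _⊗_
infixr 5 _⊸_

data Ty : Set where
  bool : Ty
  _⊗_  : Ty → Ty → Ty
  _⊸_  : Ty → Ty → Ty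

data Pos : Ty → Set where
  bool : Pos bool
  _⊗_  : ∀ {P Q} → Pos P → Pos Q → Pos (P ⊗ Q)

mutual
  data Arr : Ty → Set where
    _⊸_ : ∀ {P T} → Pos P → TyT T → Arr (P ⊸ T)

  data TyT : Ty → Set where
    pos : ∀ {P} → Pos P → TyT P
    arr : ∀ {N} → Arr N → TyT N
    ten : ∀ {P T} → Pos P → TyT T → TyT (P ⊗ T)

record Var : Set where
  constructor mkVar
  field
    name : ℕ
    ty   : Ty
open Var public

data VarTy (A : Ty) : Set where
  pos : Pos A → VarTy A
  arr : Arr A → VarTy A

-- Constants: (stochastic) matrices; only their type matters for typing.
-- dom = nothing : a 0-ary constant of type cod;
-- dom = just P  : a constant of type P ⊸ cod.
record Const : Set where
  constructor mkConst
  field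
    cname : ℕ
    dom   : Maybe Ty
    cod   : Ty
open Const public

data Pat : Set where
  pv : Var → Pat
  pp : Pat → Pat → Pat

data Exp : Set where
  var  : Var → Exp
  cst  : Const → Maybe Pat → Exp
  app  : Var → Pat → Exp
  pair : Exp → Exp → Exp
  lam  : Pat → Exp → Exp
  lett : Pat → Exp → Exp → Exp

data LTerm : Set where
  ret  : Pat → LTerm
  lett : Pat → Exp → LTerm → LTerm

patExp : Pat → Exp
patExp (pv v)   = var v
patExp (pp p q) = pair (patExp p) (patExp q)

⟦_⟧ : LTerm → Exp
⟦ ret p ⟧      = patExp p
⟦ lett p e ℓ ⟧ = lett p e ⟦ ℓ ⟧

data InPat (v : Var) : Pat → Set where
  here : InPat v (pv v)
  left  : ∀ {p q} → InPat v p → InPat v (pp p q)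
  right : ∀ {p q} → InPat v q → InPat v (pp p q)

vars : Pat → List Var
vars (pv v)   = v ∷ []
vars (pp p q) = vars p ++ vars q

PosPat : Pat → Set
PosPat p = ∀ v → InPat v p → Pos (ty v)

data Free (v : Var) : Exp → Set where
  var   : Free v (var v)
  cst   : ∀ {M x} → InPat v x → Free v (cst M (just x))
  appf  : ∀ {x} → Free v (app v x)
  appx  : ∀ {f x} → InPat v x → Free v (app f x)
  pairl : ∀ {e e'} → Free v e → Free v (pair e e')
  pairr : ∀ {e e'} → Free v e' → Free v (pair e e')
  lam   : ∀ {x e} → Free v e → ¬ InPat v x → Free v (lam x e)
  let₁  : ∀ {p e e'} → Free v e → Free v (lett p e e')
  let₂  : ∀ {p e e'} → Free v e' → ¬ InPat v p → Free v (lett p e e')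

DisjA : Exp → Exp → Set
DisjA e e' = ∀ v → Arr (ty v) → Free v e → Free v e' → ⊥

DisjP : Pat → Pat → Set
DisjP p q = ∀ v → InPat v p → InPat v q → ⊥

data Occ (v : Var) : Exp → Set where
  var   : Occ v (var v)
  cst   : ∀ {M x} → InPat v x → Occ v (cst M (just x))
  appf  : ∀ {x} → Occ v (app v x)
  appx  : ∀ {f x} → InPat v x → Occ v (app f x)
  pairl : ∀ {e e'} → Occ v e → Occ v (pair e e')
  pairr : ∀ {e e'} → Occ v e' → Occ v (pair e e')
  lamx  : ∀ {x e} → InPat v x → Occ v (lam x e)
  lame  : ∀ {x e} → Occ v e → Occ v (lam x e)
  letp  : ∀ {p e e'} → InPat v p → Occ v (lett p e e')
  let₁  : ∀ {p e e'} → Occ v e → Occ v (lett p e e')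
  let₂  : ∀ {p e e'} → Occ v e' → Occ v (lett p e e')

bound : Exp → List Var
bound (var _)      = []
bound (cst _ _)    = []
bound (app _ _)    = []
bound (pair e e')  = bound e ++ bound e'
bound (lam x e)    = vars x ++ bound e
bound (lett p e e') = vars p ++ bound e ++ bound e'

Convention : LTerm → Set
Convention ℓ = Unique (bound ⟦ ℓ ⟧) × (∀ v → v ∈ bound ⟦ ℓ ⟧ → ¬ Free v ⟦ ℓ ⟧)

data PatTy : Pat → Ty → Set where
  pv : ∀ {v} → VarTy (ty v) → PatTy (pv v) (ty v)
  pp : ∀ {p q P T} → PatTy p P → Pos P → PatTy q T → DisjP p q →
       PatTy (pp p q) (P ⊗ T)

infix 4 _⦂_

data _⦂_ : Exp → Ty → Set where
  var  : ∀ {v} → VarTy (ty v) → var v ⦂ ty v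
  app  : ∀ {f x P T} → ty f ≡ (P ⊸ T) → Arr (P ⊸ T) → PatTy x P →
         app f x ⦂ T
  cst₀ : ∀ {M} → dom M ≡ nothing → Pos (cod M) → cst M nothing ⦂ cod M
  cst₁ : ∀ {M x P} → dom M ≡ just P → Pos P → Pos (cod M) → PatTy x P →
         cst M (just x) ⦂ cod M
  pair : ∀ {e e' P T} → e ⦂ P → Pos P → e' ⦂ T → DisjA e e' →
         pair e e' ⦂ P ⊗ T
  lam  : ∀ {x e P T} → PatTy x P → Pos P → e ⦂ T → lam x e ⦂ P ⊸ T
  lett : ∀ {p e e' T U} → PatTy p T → e ⦂ T → e' ⦂ U → DisjA e e' →
         (∀ f → InPat f p → Arr (ty f) → Free f e') →
         lett p e e' ⦂ U

-- Removing a variable from a pattern: Rem v p r means r is p with v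
-- removed (r = nothing when p = v).

data Rem (v : Var) : Pat → Maybe Pat → Set where
  here   : Rem v (pv v) nothing
  left₀  : ∀ {p q} → Rem v p nothing → Rem v (pp p q) (just q)
  left₁  : ∀ {p p' q} → Rem v p (just p') → Rem v (pp p q) (just (pp p' q))
  right₀ : ∀ {p q} → Rem v q nothing → Rem v (pp p q) (just p)
  right₁ : ∀ {p q q'} → Rem v q (just q') → Rem v (pp p q) (just (pp p q'))

-- (v⃗⁺, w⃗) and (v⃗⁺, e), where an empty v⃗⁺ is simply dropped
optPat : Maybe Pat → Pat → Pat
optPat nothing  q = q
optPat (just p) q = pp p q

optPair : Maybe Pat → Exp → Exp
optPair nothing  e = e
optPair (just p) e = pair (patExp p) e

-- Rewriting rules.  Rule W r r' : the redex r rewrites to r', where W is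
-- the whole let-term (used for freshness of f in S₂).

data Rule (W : LTerm) : LTerm → LTerm → Set where
  S₁ : ∀ {p₁ e₁ p₂ e₂ ℓ} →
       (∀ v → InPat v p₁ → Free v e₂ → ⊥) →
       Rule W (lett p₁ e₁ (lett p₂ e₂ ℓ)) (lett p₂ e₂ (lett p₁ e₁ ℓ))
  S₂ : ∀ {p₁ e₁ p₂ e₂ ℓ} (x : Pat) (f : Var) →
       (∀ v → InPat v x ⇔ (InPat v p₁ × Free v e₂)) →
       Unique (vars x) →
       PosPat x →
       Arr (ty f) →
       ¬ Occ f ⟦ W ⟧ →
       (∀ {P U} → PatTy x P → e₂ ⦂ U → ty f ≡ (P ⊸ U)) →
       Rule W (lett p₁ e₁ (lett p₂ e₂ ℓ))
              (lett (pv f) (lam x e₂) (lett p₁ e₁ (lett p₂ (app f x) ℓ)))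
  S₃ : ∀ {p₁ e₁ p₂ e₂ ℓ} (f : Var) (p₁⁺ : Maybe Pat) →
       Arr (ty f) → Rem f p₁ p₁⁺ → Free f e₂ →
       Rule W (lett p₁ e₁ (lett p₂ e₂ ℓ))
              (lett (optPat p₁⁺ p₂) (lett p₁ e₁ (optPair p₁⁺ e₂)) ℓ)
  M  : ∀ {p₁ e₁ p₂ e₂ ℓ} →
       PosPat p₁ →
       Rule W (lett p₁ e₁ (lett p₂ e₂ ℓ))
              (lett (pp p₁ p₂) (lett p₁ e₁ (pair (patExp p₁) e₂)) ℓ)
  Eₓ : ∀ {p e₁ ℓ} (x : Var) (p' : Pat) →
       Pos (ty x) → ¬ Free x ⟦ ℓ ⟧ → Rem x p (just p') →
       Rule W (lett p e₁ ℓ) (lett p' (lett p e₁ (patExp p')) ℓ)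

Ctx : Set
Ctx = List (Pat × Exp)

plug : Ctx → LTerm → LTerm
plug []            r = r
plug ((p , e) ∷ C) r = lett p e (plug C r)

infix 4 _⟶_

data _⟶_ : LTerm → LTerm → Set where
  step : ∀ (C : Ctx) {r r'} → Rule (plug C r) r r' → plug C r ⟶ plug C r'

{-# OPTIONS --safe #-}
-- The let rule sees its body only through the body's type and free variables, so
-- a step inside a let-context preserves typing and free variables as soon as the
-- rewritten redex does; each rule is therefore checked on its redex alone, by
-- rebuilding the typing derivation from those of its two bindings.  The side
-- conditions of the let and pair rules only concern arrow variables: positive
-- variables never violate them, the variable convention keeps adjacent bindings
-- apart, and an arrow variable used in e₂ cannot be free in the rest of the term.
-- M and S₃ are one rewrite, merging the first binding into the second while
-- re-exporting a positive part q of its pattern (q = v⃗₁ for M, q = v⃗₁⁺ for S₃);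
-- for S₃ with v⃗₁ = f nothing is re-exported and the first binding simply sinks.
module Submission where

open import Defs
open import Data.Empty using (⊥-elim)
open import Data.List using (List; []; _∷_; _++_)
open import Data.List.Membership.Propositional using (_∈_)
open import Data.List.Membership.Propositional.Properties using (∈-++⁺ˡ; ∈-++⁺ʳ)
open import Data.List.Relation.Binary.Disjoint.Propositional using (Disjoint)
open import Data.List.Relation.Unary.All using (lookup)
open import Data.List.Relation.Unary.All.Properties using (++⁻ˡ)
open import Data.List.Relation.Unary.AllPairs using ([]; _∷_)
open import Data.List.Relation.Unary.Any using (here; there)
open import Data.List.Relation.Unary.Unique.Propositional using (Unique)
open import Data.Maybe using (just; nothing)
open import Data.Product using (_×_; _,_; ∃; proj₁; proj₂; uncurry)
open import Data.Sum using (_⊎_; inj₁; inj₂; map₁; map₂)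
open import Function using (_∘_; id)
open import Function.Bundles using (_⇔_; mk⇔; Equivalence)
open import Relation.Nullary using (¬_)
open import Relation.Binary.PropositionalEquality using (_≡_; refl; sym; subst)

open Equivalence using (to; from)

module _ {A : Set} where

  Unique-++⁻ˡ : ∀ (xs : List A) {ys} → Unique (xs ++ ys) → Unique xs
  Unique-++⁻ˡ []       _         = []
  Unique-++⁻ˡ (x ∷ xs) (x∉ ∷ u) = ++⁻ˡ xs x∉ ∷ Unique-++⁻ˡ xs u

  Unique-++⁻ʳ : ∀ (xs : List A) {ys} → Unique (xs ++ ys) → Unique ys
  Unique-++⁻ʳ []       u       = u
  Unique-++⁻ʳ (x ∷ xs) (_ ∷ u) = Unique-++⁻ʳ xs u

  Unique-++⇒Disjoint : ∀ (xs : List A) {ys} → Unique (xs ++ ys) → Disjoint xs ys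
  Unique-++⇒Disjoint (x ∷ xs) (x∉ ∷ _) (here refl , v∈ys) = lookup x∉ (∈-++⁺ʳ xs v∈ys) refl
  Unique-++⇒Disjoint (x ∷ xs) (_ ∷ u)  (there v∈xs , v∈ys) = Unique-++⇒Disjoint xs u (v∈xs , v∈ys)

InPat⇒∈vars : ∀ {v p} → InPat v p → v ∈ vars p
InPat⇒∈vars here          = here refl
InPat⇒∈vars (left i)      = ∈-++⁺ˡ (InPat⇒∈vars i)
InPat⇒∈vars (right {p} i) = ∈-++⁺ʳ (vars p) (InPat⇒∈vars i)

Free-patExp⁺ : ∀ {v p} → InPat v p → Free v (patExp p)
Free-patExp⁺ here      = var
Free-patExp⁺ (left i)  = pairl (Free-patExp⁺ i)
Free-patExp⁺ (right i) = pairr (Free-patExp⁺ i)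

Free-patExp⁻ : ∀ {v} p → Free v (patExp p) → InPat v p
Free-patExp⁻ (pv _)   var       = here
Free-patExp⁻ (pp p _) (pairl f) = left (Free-patExp⁻ p f)
Free-patExp⁻ (pp _ q) (pairr f) = right (Free-patExp⁻ q f)

Free⇒Occ : ∀ {v e} → Free v e → Occ v e
Free⇒Occ var        = var
Free⇒Occ (cst i)    = cst i
Free⇒Occ appf       = appf
Free⇒Occ (appx i)   = appx i
Free⇒Occ (pairl f)  = pairl (Free⇒Occ f)
Free⇒Occ (pairr f)  = pairr (Free⇒Occ f)
Free⇒Occ (lam f _)  = lame (Free⇒Occ f)
Free⇒Occ (let₁ f)   = let₁ (Free⇒Occ f)
Free⇒Occ (let₂ f _) = let₂ (Free⇒Occ f)

Pos⇒¬Arr : ∀ {A} → Pos A → ¬ Arr A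
Pos⇒¬Arr () (_ ⊸ _)

PatTy-Pos⇒PosPat : ∀ {p P} → PatTy p P → Pos P → PosPat p
PatTy-Pos⇒PosPat (pv _)         P⁺       _ here      = P⁺
PatTy-Pos⇒PosPat (pp pt P⁺ _ _) _        v (left i)  = PatTy-Pos⇒PosPat pt P⁺ v i
PatTy-Pos⇒PosPat (pp _ _ qt _)  (_ ⊗ Q⁺) v (right i) = PatTy-Pos⇒PosPat qt Q⁺ v i

PosPat⇒Pos : ∀ {p T} → PatTy p T → PosPat p → Pos T
PosPat⇒Pos (pv _)         p⁺ = p⁺ _ here
PosPat⇒Pos (pp _ P⁺ qt _) p⁺ = P⁺ ⊗ PosPat⇒Pos qt (λ v → p⁺ v ∘ right)

patExp-⦂ : ∀ {p T} → PatTy p T → patExp p ⦂ T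
patExp-⦂ (pv vt)                  = var vt
patExp-⦂ {pp p _} (pp pt P⁺ qt _) = pair (patExp-⦂ pt) P⁺ (patExp-⦂ qt) p-noArr
  where
  p-noArr : DisjA (patExp p) _
  p-noArr v a f _ = Pos⇒¬Arr (PatTy-Pos⇒PosPat pt P⁺ v (Free-patExp⁻ p f)) a

PosPat⇒PatTy : ∀ x → Unique (vars x) → PosPat x → ∃ λ P → PatTy x P × Pos P
PosPat⇒PatTy (pv v)   _ x⁺ = _ , pv (pos (x⁺ v here)) , x⁺ v here
PosPat⇒PatTy (pp a b) u x⁺
  with PosPat⇒PatTy a (Unique-++⁻ˡ (vars a) u) (λ v → x⁺ v ∘ left)
     | PosPat⇒PatTy b (Unique-++⁻ʳ (vars a) u) (λ v → x⁺ v ∘ right)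
... | _ , at , A⁺ | _ , bt , B⁺ =
  _ , pp at A⁺ bt a∩b , A⁺ ⊗ B⁺
  where
  a∩b : DisjP a b
  a∩b v i j = Unique-++⇒Disjoint (vars a) u (InPat⇒∈vars i , InPat⇒∈vars j)

Rem⇒InPat : ∀ {v p m} → Rem v p m → InPat v p
Rem⇒InPat here       = here
Rem⇒InPat (left₀ r)  = left (Rem⇒InPat r)
Rem⇒InPat (left₁ r)  = left (Rem⇒InPat r)
Rem⇒InPat (right₀ r) = right (Rem⇒InPat r)
Rem⇒InPat (right₁ r) = right (Rem⇒InPat r)

Rem-⊆ : ∀ {v p p' w} → Rem v p (just p') → InPat w p' → InPat w p
Rem-⊆ (left₀ r)  i         = right i
Rem-⊆ (left₁ r)  (left i)  = left (Rem-⊆ r i)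
Rem-⊆ (left₁ r)  (right i) = right i
Rem-⊆ (right₀ r) i         = left i
Rem-⊆ (right₁ r) (left i)  = left i
Rem-⊆ (right₁ r) (right i) = right (Rem-⊆ r i)

Rem-cover : ∀ {v p p' w} → Rem v p (just p') → InPat w p → InPat w p' ⊎ w ≡ v
Rem-cover (left₀ here)  (left here)  = inj₂ refl
Rem-cover (left₀ here)  (right i)    = inj₁ i
Rem-cover (left₁ r)     (left i)     = map₁ left (Rem-cover r i)
Rem-cover (left₁ r)     (right i)    = inj₁ (right i)
Rem-cover (right₀ here) (left i)     = inj₁ i
Rem-cover (right₀ here) (right here) = inj₂ refl
Rem-cover (right₁ r)    (left i)     = inj₁ (left i)
Rem-cover (right₁ r)    (right i)    = map₁ right (Rem-cover r i)

Rem-PatTy : ∀ {x p p' T} → PatTy p T → Rem x p (just p') → ∃ λ T' → PatTy p' T'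
Rem-PatTy (pp _  _ qt _) (left₀ here)  = _ , qt
Rem-PatTy (pp pt _ _  _) (right₀ here) = _ , pt
Rem-PatTy (pp pt P⁺ qt p∩q) (left₁ r) with Rem-PatTy pt r
... | _ , pt' = _ , pp pt' (PosPat⇒Pos pt' p'⁺) qt (λ v → p∩q v ∘ Rem-⊆ r)
  where
  p'⁺ : PosPat _
  p'⁺ v = PatTy-Pos⇒PosPat pt P⁺ v ∘ Rem-⊆ r
Rem-PatTy (pp pt P⁺ qt p∩q) (right₁ r) with Rem-PatTy qt r
... | _ , qt' = _ , pp pt P⁺ qt' (λ v i → p∩q v i ∘ Rem-⊆ r)

Rem-Arr-PatTy : ∀ {f p p' T} → PatTy p T → Arr (ty f) → Rem f p (just p') →
                ∃ λ P → PatTy p' P × Pos P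
Rem-Arr-PatTy (pp pt P⁺ _ _) a (left₀ r)     = ⊥-elim (Pos⇒¬Arr (PatTy-Pos⇒PosPat pt P⁺ _ (Rem⇒InPat r)) a)
Rem-Arr-PatTy (pp pt P⁺ _ _) a (left₁ r)     = ⊥-elim (Pos⇒¬Arr (PatTy-Pos⇒PosPat pt P⁺ _ (Rem⇒InPat r)) a)
Rem-Arr-PatTy (pp pt P⁺ _ _) a (right₀ here) = _ , pt , P⁺
Rem-Arr-PatTy (pp pt P⁺ qt p∩q) a (right₁ r) with Rem-Arr-PatTy qt a r
... | _ , qt' , Q⁺ = _ , pp pt P⁺ qt' (λ v i → p∩q v i ∘ Rem-⊆ r) , P⁺ ⊗ Q⁺

_#_ : Pat → Exp → Set
p # e = ∀ v → InPat v p → ¬ Free v e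

SameFV : Exp → Exp → Set
SameFV e e' = ∀ v → Free v e ⇔ Free v e'

Preserves : Exp → Exp → Set
Preserves e e' = ∀ {T} → e ⦂ T → e' ⦂ T × SameFV e e'

Preserves-lett : ∀ p e₀ {e e'} → Preserves e e' → Preserves (lett p e₀ e) (lett p e₀ e')
Preserves-lett p e₀ h (lett pt t₀ t disj used) =
  lett pt t₀ t' (λ v a f₀ f → disj v a f₀ (from (fv v) f)) (λ g i a → to (fv g) (used g i a)) ,
  λ v → mk⇔ (λ { (let₁ f₀) → let₁ f₀ ; (let₂ f n) → let₂ (to (fv v) f) n })
            (λ { (let₁ f₀) → let₁ f₀ ; (let₂ f n) → let₂ (from (fv v) f) n })
  where
  t' = proj₁ (h t)
  fv = proj₂ (h t)

Preserves-plug : ∀ C {r r'} → Preserves ⟦ r ⟧ ⟦ r' ⟧ → Preserves ⟦ plug C r ⟧ ⟦ plug C r' ⟧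
Preserves-plug []            h = h
Preserves-plug ((p , e) ∷ C) h = Preserves-lett p e (Preserves-plug C h)

swap-lets : ∀ {p₁ e₁ p₂ e₂ L} → p₁ # e₂ → DisjP p₁ p₂ → p₂ # e₁ →
            Preserves (lett p₁ e₁ (lett p₂ e₂ L)) (lett p₂ e₂ (lett p₁ e₁ L))
swap-lets {p₁} {e₁} {p₂} {e₂} {L} p₁#e₂ p₁∩p₂ p₂#e₁
          (lett pt₁ t₁ (lett pt₂ t₂ t disj₂ used₂) disj₁ used₁) =
  lett pt₂ t₂ (lett pt₁ t₁ t disj₁' used₁') disj₂' used₂' , fv
  where
  disj₁' : DisjA e₁ L
  disj₁' v a f₁ f = disj₁ v a f₁ (let₂ f (λ j → p₂#e₁ v j f₁))
  used₁' : ∀ g → InPat g p₁ → Arr (ty g) → Free g L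
  used₁' g i a with used₁ g i a
  ... | let₁ f₂  = ⊥-elim (p₁#e₂ g i f₂)
  ... | let₂ f _ = f
  disj₂' : DisjA e₂ (lett p₁ e₁ L)
  disj₂' v a f₂ (let₁ f₁)  = disj₁ v a f₁ (let₁ f₂)
  disj₂' v a f₂ (let₂ f _) = disj₂ v a f₂ f
  used₂' : ∀ g → InPat g p₂ → Arr (ty g) → Free g (lett p₁ e₁ L)
  used₂' g j a = let₂ (used₂ g j a) (λ i → p₁∩p₂ g i j)
  fv : SameFV (lett p₁ e₁ (lett p₂ e₂ L)) (lett p₂ e₂ (lett p₁ e₁ L))
  fv v = mk⇔
    (λ { (let₁ f₁)             → let₂ (let₁ f₁) (λ j → p₂#e₁ v j f₁)
       ; (let₂ (let₁ f₂) _)    → let₁ f₂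
       ; (let₂ (let₂ f n₂) n₁) → let₂ (let₂ f n₁) n₂ })
    (λ { (let₁ f₂)             → let₂ (let₁ f₂) (λ i → p₁#e₂ v i f₂)
       ; (let₂ (let₁ f₁) _)    → let₁ f₁
       ; (let₂ (let₂ f n₁) n₂) → let₂ (let₂ f n₂) n₁ })

lambda-lift : ∀ {p₁ e₁ p₂ e₂ L} (x : Pat) (f : Var) →
              (∀ v → InPat v x ⇔ (InPat v p₁ × Free v e₂)) →
              Unique (vars x) → PosPat x → Arr (ty f) →
              ¬ Occ f (lett p₁ e₁ (lett p₂ e₂ L)) →
              (∀ {P U} → PatTy x P → e₂ ⦂ U → ty f ≡ (P ⊸ U)) →
              Preserves (lett p₁ e₁ (lett p₂ e₂ L))
                        (lett (pv f) (lam x e₂) (lett p₁ e₁ (lett p₂ (app f x) L)))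
lambda-lift {p₁} {e₁} {p₂} {e₂} {L} x f x≡p₁∩e₂ x-uniq x⁺ f⁻ f-fresh f-ty
            (lett pt₁ t₁ (lett pt₂ t₂ t disj₂ used₂) disj₁ used₁)
  with PosPat⇒PatTy x x-uniq x⁺
... | _ , xt , P⁺ =
  lett (pv (arr f⁻)) (subst (lam x e₂ ⦂_) (sym f≡) (lam xt P⁺ t₂)) body disj-λ used-f , fv
  where
  f≡ = f-ty xt t₂
  x-noArr : ∀ {v} → InPat v x → ¬ Arr (ty v)
  x-noArr {v} = Pos⇒¬Arr ∘ x⁺ v
  disj-app : DisjA (app f x) L
  disj-app v a appf     fL = f-fresh (let₂ (let₂ (Free⇒Occ fL)))
  disj-app v a (appx i) _  = x-noArr i a
  disj₁' : DisjA e₁ (lett p₂ (app f x) L)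
  disj₁' v a f₁ (let₁ appf)     = f-fresh (let₁ (Free⇒Occ f₁))
  disj₁' v a f₁ (let₁ (appx i)) = x-noArr i a
  disj₁' v a f₁ (let₂ fL n)     = disj₁ v a f₁ (let₂ fL n)
  used₁' : ∀ g → InPat g p₁ → Arr (ty g) → Free g (lett p₂ (app f x) L)
  used₁' g i a with used₁ g i a
  ... | let₁ f₂   = ⊥-elim (x-noArr (from (x≡p₁∩e₂ g) (i , f₂)) a)
  ... | let₂ fL n = let₂ fL n
  body = lett pt₁ t₁ (lett pt₂ (app f≡ (subst Arr f≡ f⁻) xt) t disj-app used₂) disj₁' used₁'
  disj-λ : DisjA (lam x e₂) (lett p₁ e₁ (lett p₂ (app f x) L))
  disj-λ v a (lam f₂ _)  (let₁ f₁)                = disj₁ v a f₁ (let₁ f₂)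
  disj-λ v a (lam f₂ _)  (let₂ (let₁ appf) _)     = f-fresh (let₂ (let₁ (Free⇒Occ f₂)))
  disj-λ v a (lam _ v∉x) (let₂ (let₁ (appx i)) _) = v∉x i
  disj-λ v a (lam f₂ _)  (let₂ (let₂ fL _) _)     = disj₂ v a f₂ fL
  used-f : ∀ g → InPat g (pv f) → Arr (ty g) → Free g (lett p₁ e₁ (lett p₂ (app f x) L))
  used-f g here _ = let₂ (let₁ appf) (f-fresh ∘ letp)
  f∉FV : ∀ {v} → Free v (lett p₁ e₁ (lett p₂ e₂ L)) → ¬ InPat v (pv f)
  f∉FV fr here = f-fresh (Free⇒Occ fr)
  fv : SameFV (lett p₁ e₁ (lett p₂ e₂ L)) (lett (pv f) (lam x e₂) (lett p₁ e₁ (lett p₂ (app f x) L)))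
  fv v = mk⇔
    (λ { fr@(let₁ f₁)              → let₂ (let₁ f₁) (f∉FV fr)
       ; (let₂ (let₁ f₂) n₁)         → let₁ (lam f₂ (n₁ ∘ proj₁ ∘ to (x≡p₁∩e₂ v)))
       ; fr@(let₂ (let₂ fL n₂) n₁)   → let₂ (let₂ (let₂ fL n₂) n₁) (f∉FV fr) })
    (λ { (let₁ (lam f₂ v∉x))               → let₂ (let₁ f₂) (λ i → v∉x (from (x≡p₁∩e₂ v) (i , f₂)))
       ; (let₂ (let₁ f₁) _)                 → let₁ f₁
       ; (let₂ (let₂ (let₁ appf) _) v≢f)    → ⊥-elim (v≢f here)
       ; (let₂ (let₂ (let₁ (appx i)) n₁) _) → ⊥-elim (n₁ (proj₁ (to (x≡p₁∩e₂ v) i)))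
       ; (let₂ (let₂ (let₂ fL n₂) n₁) _)  → let₂ (let₂ fL n₂) n₁ })

merge-lets : ∀ {p₁ e₁ p₂ e₂ L} (q : Pat) →
             (∀ {T} → PatTy p₁ T → ∃ λ Q → PatTy q Q × Pos Q) →
             (∀ {v} → InPat v q → InPat v p₁) →
             (∀ {v} → InPat v p₁ → InPat v q ⊎ Arr (ty v) × Free v e₂) →
             DisjP p₁ p₂ → p₂ # e₁ →
             Preserves (lett p₁ e₁ (lett p₂ e₂ L))
                       (lett (pp q p₂) (lett p₁ e₁ (pair (patExp q) e₂)) L)
merge-lets {p₁} {e₁} {p₂} {e₂} {L} q q-ty q⊆p₁ p₁⊆q∪e₂ p₁∩p₂ p₂#e₁
           (lett pt₁ t₁ (lett pt₂ t₂ t disj₂ used₂) disj₁ used₁)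
  with q-ty pt₁
... | _ , qt , Q⁺ =
  lett (pp qt Q⁺ pt₂ (λ v → p₁∩p₂ v ∘ q⊆p₁)) merged t disj used , fv
  where
  q-noArr : ∀ {v} → Free v (patExp q) → ¬ Arr (ty v)
  q-noArr {v} = Pos⇒¬Arr ∘ PatTy-Pos⇒PosPat qt Q⁺ v ∘ Free-patExp⁻ q
  disj₁' : DisjA e₁ (pair (patExp q) e₂)
  disj₁' v a f₁ (pairl fq) = q-noArr fq a
  disj₁' v a f₁ (pairr f₂) = disj₁ v a f₁ (let₁ f₂)
  used₁' : ∀ g → InPat g p₁ → Arr (ty g) → Free g (pair (patExp q) e₂)
  used₁' g i a with p₁⊆q∪e₂ i
  ... | inj₁ iq       = ⊥-elim (q-noArr (Free-patExp⁺ iq) a)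
  ... | inj₂ (_ , f₂) = pairr f₂
  merged = lett pt₁ t₁ (pair (patExp-⦂ qt) Q⁺ t₂ (λ v a fq _ → q-noArr fq a)) disj₁' used₁'
  disj : DisjA (lett p₁ e₁ (pair (patExp q) e₂)) L
  disj v a (let₁ f₁)           fL = disj₁ v a f₁ (let₂ fL (λ j → p₂#e₁ v j f₁))
  disj v a (let₂ (pairl fq) n) _  = n (q⊆p₁ (Free-patExp⁻ q fq))
  disj v a (let₂ (pairr f₂) _) fL = disj₂ v a f₂ fL
  used : ∀ g → InPat g (pp q p₂) → Arr (ty g) → Free g L
  used g (left i)  a = ⊥-elim (q-noArr (Free-patExp⁺ i) a)
  used g (right j) a = used₂ g j a
  p₁∖q∉FV : ∀ {v} → Free v L → ¬ InPat v q → ¬ InPat v p₁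
  p₁∖q∉FV fL v∉q i with p₁⊆q∪e₂ i
  ... | inj₁ iq       = v∉q iq
  ... | inj₂ (a , f₂) = disj₂ _ a f₂ fL
  fv : SameFV (lett p₁ e₁ (lett p₂ e₂ L)) (lett (pp q p₂) (lett p₁ e₁ (pair (patExp q) e₂)) L)
  fv v = mk⇔
    (λ { (let₁ f₁)              → let₁ (let₁ f₁)
       ; (let₂ (let₁ f₂) n₁)    → let₁ (let₂ (pairr f₂) n₁)
       ; (let₂ (let₂ fL n₂) n₁) → let₂ fL (λ { (left i) → n₁ (q⊆p₁ i) ; (right j) → n₂ j }) })
    (λ { (let₁ (let₁ f₁))           → let₁ f₁
       ; (let₁ (let₂ (pairl fq) n)) → ⊥-elim (n (q⊆p₁ (Free-patExp⁻ q fq)))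
       ; (let₁ (let₂ (pairr f₂) n)) → let₂ (let₁ f₂) n
       ; (let₂ fL n)                → let₂ (let₂ fL (n ∘ right)) (p₁∖q∉FV fL (n ∘ left)) })

sink-let : ∀ {p₁ e₁ p₂ e₂ L} →
           (∀ {v} → InPat v p₁ → Arr (ty v) × Free v e₂) → p₂ # e₁ →
           Preserves (lett p₁ e₁ (lett p₂ e₂ L)) (lett p₂ (lett p₁ e₁ e₂) L)
sink-let {p₁} {e₁} {p₂} {e₂} {L} p₁⊆e₂ p₂#e₁
         (lett pt₁ t₁ (lett pt₂ t₂ t disj₂ used₂) disj₁ _) =
  lett pt₂ (lett pt₁ t₁ t₂ disj₁' (λ g i _ → proj₂ (p₁⊆e₂ i))) t disj used₂ , fv
  where
  disj₁' : DisjA e₁ e₂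
  disj₁' v a f₁ f₂ = disj₁ v a f₁ (let₁ f₂)
  disj : DisjA (lett p₁ e₁ e₂) L
  disj v a (let₁ f₁)   fL = disj₁ v a f₁ (let₂ fL (λ j → p₂#e₁ v j f₁))
  disj v a (let₂ f₂ _) fL = disj₂ v a f₂ fL
  p₁∉FV : ∀ {v} → Free v L → ¬ InPat v p₁
  p₁∉FV fL i = disj₂ _ (proj₁ (p₁⊆e₂ i)) (proj₂ (p₁⊆e₂ i)) fL
  fv : SameFV (lett p₁ e₁ (lett p₂ e₂ L)) (lett p₂ (lett p₁ e₁ e₂) L)
  fv v = mk⇔
    (λ { (let₁ f₁)             → let₁ (let₁ f₁)
       ; (let₂ (let₁ f₂) n₁)   → let₁ (let₂ f₂ n₁)
       ; (let₂ (let₂ fL n₂) _) → let₂ fL n₂ })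
    (λ { (let₁ (let₁ f₁))    → let₁ f₁
       ; (let₁ (let₂ f₂ n₁)) → let₂ (let₁ f₂) n₁
       ; (let₂ fL n₂)        → let₂ (let₂ fL n₂) (p₁∉FV fL) })

prune-let : ∀ {p e L} (x : Var) (p' : Pat) →
            Pos (ty x) → ¬ Free x L → Rem x p (just p') → p # e →
            Preserves (lett p e L) (lett p' (lett p e (patExp p')) L)
prune-let {p} {e} {L} x p' x⁺ x∉L rm p#e (lett pt t₀ t disj₀ used₀) =
  lett pt' (lett pt t₀ (patExp-⦂ pt') disj' used') t disj used , fv
  where
  pt' = proj₂ (Rem-PatTy pt rm)
  disj' : DisjA e (patExp p')
  disj' v _ f fp' = p#e v (Rem-⊆ rm (Free-patExp⁻ p' fp')) f
  used' : ∀ g → InPat g p → Arr (ty g) → Free g (patExp p')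
  used' g i a with Rem-cover rm i
  ... | inj₁ i'   = Free-patExp⁺ i'
  ... | inj₂ refl = ⊥-elim (Pos⇒¬Arr x⁺ a)
  disj : DisjA (lett p e (patExp p')) L
  disj v a (let₁ f)     fL = disj₀ v a f fL
  disj v a (let₂ fp' n) _  = n (Rem-⊆ rm (Free-patExp⁻ p' fp'))
  used : ∀ g → InPat g p' → Arr (ty g) → Free g L
  used g = used₀ g ∘ Rem-⊆ rm
  p∖p'∉FV : ∀ {v} → Free v L → ¬ InPat v p' → ¬ InPat v p
  p∖p'∉FV fL v∉p' i with Rem-cover rm i
  ... | inj₁ i'   = v∉p' i'
  ... | inj₂ refl = x∉L fL
  fv : SameFV (lett p e L) (lett p' (lett p e (patExp p')) L)
  fv v = mk⇔
    (λ { (let₁ f)    → let₁ (let₁ f)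
       ; (let₂ fL n) → let₂ fL (n ∘ Rem-⊆ rm) })
    (λ { (let₁ (let₁ f))     → let₁ f
       ; (let₁ (let₂ fp' n)) → ⊥-elim (n (Rem-⊆ rm (Free-patExp⁻ p' fp')))
       ; (let₂ fL n)         → let₂ fL (p∖p'∉FV fL n) })

Convention-lett : ∀ {p e} ℓ → Convention (lett p e ℓ) → Convention ℓ
Convention-lett {p} {e} ℓ (uniq , bound∉FV) =
  Unique-++⁻ʳ (bound e) (Unique-++⁻ʳ (vars p) uniq) , λ v v∈ fr → bound∉FV v (inner v∈) (let₂ fr (p∉ v∈))
  where
  inner : ∀ {v} → v ∈ bound ⟦ ℓ ⟧ → v ∈ bound ⟦ lett p e ℓ ⟧
  inner = ∈-++⁺ʳ (vars p) ∘ ∈-++⁺ʳ (bound e)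
  p∉ : ∀ {v} → v ∈ bound ⟦ ℓ ⟧ → ¬ InPat v p
  p∉ v∈ i = Unique-++⇒Disjoint (vars p) uniq (InPat⇒∈vars i , ∈-++⁺ʳ (bound e) v∈)

Convention-plug : ∀ C {r} → Convention (plug C r) → Convention r
Convention-plug []            c = c
Convention-plug ((p , e) ∷ C) c = Convention-plug C (Convention-lett (plug C _) c)

Convention⇒# : ∀ {p e} ℓ → Convention (lett p e ℓ) → p # e
Convention⇒# _ (_ , bound∉FV) v i f = bound∉FV v (∈-++⁺ˡ (InPat⇒∈vars i)) (let₁ f)

Convention⇒adjacent : ∀ {p₁ e₁ p₂ e₂} ℓ → Convention (lett p₁ e₁ (lett p₂ e₂ ℓ)) →
                      DisjP p₁ p₂ × p₂ # e₁
Convention⇒adjacent {p₁} {e₁} _ (uniq , bound∉FV) =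
  (λ v i j → Unique-++⇒Disjoint (vars p₁) uniq (InPat⇒∈vars i , p₂⊆bound j)) ,
  (λ v j f → bound∉FV v (∈-++⁺ʳ (vars p₁) (p₂⊆bound j)) (let₁ f))
  where
  p₂⊆bound : ∀ {v} → InPat v _ → v ∈ bound e₁ ++ _
  p₂⊆bound = ∈-++⁺ʳ (bound e₁) ∘ ∈-++⁺ˡ ∘ InPat⇒∈vars

Occ-plug : ∀ C {r v} → Occ v ⟦ r ⟧ → Occ v ⟦ plug C r ⟧
Occ-plug []      o = o
Occ-plug (_ ∷ C) o = let₂ (Occ-plug C o)

Rule-preserves : ∀ C {r r'} → Convention r → Rule (plug C r) r r' → Preserves ⟦ r ⟧ ⟦ r' ⟧
Rule-preserves C c (S₁ {ℓ = ℓ} p₁#e₂) = uncurry (swap-lets p₁#e₂) (Convention⇒adjacent ℓ c)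
Rule-preserves C c (S₂ x f x≡p₁∩e₂ x-uniq x⁺ f⁻ f-fresh f-ty) =
  lambda-lift x f x≡p₁∩e₂ x-uniq x⁺ f⁻ (f-fresh ∘ Occ-plug C) f-ty
Rule-preserves C c (S₃ {ℓ = ℓ} f nothing f⁻ here f∈e₂) =
  sink-let (λ { here → f⁻ , f∈e₂ }) (proj₂ (Convention⇒adjacent ℓ c))
Rule-preserves C c (S₃ {ℓ = ℓ} f (just p') f⁻ rm f∈e₂) =
  uncurry (merge-lets p' (λ pt → Rem-Arr-PatTy pt f⁻ rm) (Rem-⊆ rm)
                         (map₂ (λ { refl → f⁻ , f∈e₂ }) ∘ Rem-cover rm))
          (Convention⇒adjacent ℓ c)
Rule-preserves C c (M {p₁} {ℓ = ℓ} p₁⁺) =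
  uncurry (merge-lets p₁ (λ pt → _ , pt , PosPat⇒Pos pt p₁⁺) id inj₁) (Convention⇒adjacent ℓ c)
Rule-preserves C c (Eₓ {ℓ = ℓ} x p' x⁺ x∉ℓ rm) = prune-let x p' x⁺ x∉ℓ rm (Convention⇒# ℓ c)

proposition5 : ∀ {ℓ ℓ' : LTerm} {T : Ty} →
    Convention ℓ → ℓ ⟶ ℓ' → ⟦ ℓ ⟧ ⦂ T →
    (⟦ ℓ' ⟧ ⦂ T) × (∀ v → Free v ⟦ ℓ ⟧ ⇔ Free v ⟦ ℓ' ⟧)
proposition5 c (step C rule) = Preserves-plug C (Rule-preserves C (Convention-plug C c) rule)
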